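{- Let $n\geq 2$ and let $(F_0,F_1,F_2,F_3)$ be a type-II 2-factorization of $\vec{C}_n\wr\vec{C}_3$, with $F_0$ of type 2, $F_1$ of type 1, and $F_2,F_3$ of type 0. Let $i\in\mathbb{Z}_n$. If $F_1$ is switched at $i$, then $\pi_i(F_2),\pi_i(F_3) \in \{(0\,1\,2), (0\,2\,1), \mathrm{id}\}$. Otherwise, $\pi_i(F_2),\pi_i(F_3) \in \{(0\,1), (0\,2), (1\,2)\}$.
   Context: Let $V(\vec{C}_n)=\mathbb{Z}_n$ with arcs $(i,i+1)$ and $V(\vec{C}_3)=\mathbb{Z}_3$ with arcs $(j,j+1)$; $\vec{C}_n\wr\vec{C}_3$ has vertex set $\mathbb{Z}_n\times\mathbb{Z}_3$, with $((g_1,h_1),(g_2,h_2))$ an arc iff $g_2=g_1+1$, or $g_1=g_2$ and $h_2=h_1+1$. Write $i_j$ for $(i,j)$, $V_i=\{i_0,i_1,i_2\}$, and $C^i_3$ for the directed 3-cycle $i_0\,i_1\,i_2\,i_0$. A directed 2-factor is a spanning subdigraph that is a vertex-disjoint union of directed cycles; it is of type $k$ if it contains exactly $k$ arcs of $C^i_3$ for every $i$. A type-II 2-factorization is a partition of the arc set into four directed 2-factors: one of type 2, one of type 1 and two of type 0. For a 2-factor $F$, $F[i]$ is the subdigraph on $V_i\cup V_{i+1}$ consisting of arcs of $F$ lying in $C^i_3$, $C^{i+1}_3$, or going from $V_i$ to $V_{i+1}$; for a type-1 factor $F$, $F[i]$ is a union of two disjoint dipaths of total length 4, and $F$ is switched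 at $i$ if both have length 2. For a type-0 factor $F$, its arcs with tail in $V_i$ are $(i_j,(i+1)_{j^{\pi}})$, $j\in\mathbb{Z}_3$, for a unique permutation $\pi=\pi_i(F)$ of $\mathbb{Z}_3$ (written in cycle notation). -}

module Defs where

open import Data.Nat using (ℕ; zero; suc; _+_)
open import Data.Nat.DivMod using (_mod_)
open import Data.Fin using (Fin; toℕ) renaming (zero to f0; suc to fs)
open import Data.Fin.Properties using (_≟_)
open import Data.Bool using (Bool; true; false; _∨_; _∧_; T; if_then_else_)
open import Data.Product using (Σ; _×_; _,_)
open import Data.Sum using (_⊎_)
open import Data.List using (List; []; _∷_)
open import Data.List.Relation.Unary.Unique.Propositional using (Unique)
open import Relation.Nullary using (¬_)
open import Relation.Nullary.Decidable using (⌊_⌋)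
open import Relation.Binary.PropositionalEquality using (_≡_)

sucMod : ∀ {n} → Fin n → Fin n
sucMod {suc m} i = suc (toℕ i) mod suc m

-- vertices i_j of C_n wr C_3
V : ℕ → Set
V n = Fin n × Fin 3

isArc : ∀ {n} → V n → V n → Bool
isArc (g₁ , h₁) (g₂ , h₂) =
  ⌊ g₂ ≟ sucMod g₁ ⌋ ∨ (⌊ g₁ ≟ g₂ ⌋ ∧ ⌊ h₂ ≟ sucMod h₁ ⌋)

Subdigraph : ℕ → Set
Subdigraph n = V n → V n → Bool

Is2Factor : ∀ {n} → Subdigraph n → Set
Is2Factor {n} F =
  (∀ u → Σ (V n) λ v → T (F u v) × (∀ w → T (F u w) → w ≡ v)) ×
  (∀ v → Σ (V n) λ u → T (F u v) × (∀ w → T (F w v) → w ≡ u))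

b2n : Bool → ℕ
b2n true = 1
b2n false = 0

c3count : ∀ {n} → Subdigraph n → Fin n → ℕ
c3count F i =
  b2n (F (i , f0) (i , fs f0)) +
  b2n (F (i , fs f0) (i , fs (fs f0))) +
  b2n (F (i , fs (fs f0)) (i , f0))

HasType : ∀ {n} → ℕ → Subdigraph n → Set
HasType k F = ∀ i → c3count F i ≡ k

Is2Factorization : ∀ {n} → (Fin 4 → Subdigraph n) → Set
Is2Factorization {n} F =
  (∀ k u v → T (F k u v) → T (isArc u v)) ×
  (∀ u v → T (isArc u v) →
     Σ (Fin 4) λ k → T (F k u v) × (∀ l → T (F l u v) → l ≡ k)) ×
  (∀ k → Is2Factor (F k))

IsTypeII : ∀ {n} → (Fin 4 → Subdigraph n) → Set
IsTypeII F =
  Is2Factorization F ×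
  HasType 2 (F f0) × HasType 1 (F (fs f0)) ×
  HasType 0 (F (fs (fs f0))) × HasType 0 (F (fs (fs (fs f0))))

-- (u , v) is an arc position considered in F[i]: inside V_i, inside V_{i+1},
-- or from V_i to V_{i+1}
InWindow : ∀ {n} → Fin n → V n → V n → Set
InWindow i (g₁ , _) (g₂ , _) =
  (g₁ ≡ i × g₂ ≡ i) ⊎ (g₁ ≡ sucMod i × g₂ ≡ sucMod i) ⊎ (g₁ ≡ i × g₂ ≡ sucMod i)

-- F is switched at i: F[i] is the union of two disjoint dipaths a b c and
-- d e f, each of length 2 (six distinct vertices)
SwitchedAt : ∀ {n} → Subdigraph n → Fin n → Set
SwitchedAt {n} F i =
  Σ (V n) λ a → Σ (V n) λ b → Σ (V n) λ c →
  Σ (V n) λ d → Σ (V n) λ e → Σ (V n) λ f →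
    Unique (a ∷ b ∷ c ∷ d ∷ e ∷ f ∷ []) ×
    (∀ u v → (T (F u v) × InWindow i u v) →
       ((u , v) ≡ (a , b) ⊎ (u , v) ≡ (b , c) ⊎
        (u , v) ≡ (d , e) ⊎ (u , v) ≡ (e , f))) ×
    (∀ u v → ((u , v) ≡ (a , b) ⊎ (u , v) ≡ (b , c) ⊎
              (u , v) ≡ (d , e) ⊎ (u , v) ≡ (e , f)) →
       (T (F u v) × InWindow i u v))

idP c012 c021 t01 t02 t12 : Fin 3 → Fin 3
idP j = j
c012 f0 = fs f0
c012 (fs f0) = fs (fs f0)
c012 (fs (fs f0)) = f0
c021 f0 = fs (fs f0)
c021 (fs f0) = f0
c021 (fs (fs f0)) = fs f0
t01 f0 = fs f0
t01 (fs f0) = f0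
t01 (fs (fs f0)) = fs (fs f0)
t02 f0 = fs (fs f0)
t02 (fs f0) = fs f0
t02 (fs (fs f0)) = f0
t12 f0 = f0
t12 (fs f0) = fs (fs f0)
t12 (fs (fs f0)) = fs f0

-- π_i(F) = σ : the arcs of F with tail in V_i are (i_j , (i+1)_{σ j})
PiIs : ∀ {n} → Subdigraph n → Fin n → (Fin 3 → Fin 3) → Set
PiIs F i σ = ∀ j → T (F (i , j) (sucMod i , σ j))

{-# OPTIONS --safe #-}
module Submission where

-- Between the layers V_i and V_{i+1} the type-0 factors F₂ and F₃ act by permutations
-- π₂, π₃ of ℤ₃ that differ at every point; since an even and an odd permutation of ℤ₃
-- always agree somewhere, π₂ and π₃ have the same parity. Let M j be the value other than
-- π₂ j and π₃ j: M is a rotation j ↦ j + c when π₂, π₃ are even and a reflection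
-- j ↦ c − j when they are odd. If t → t+1 and u → u+1 are the arcs of F₁ in C^i_3 and
-- C^{i+1}_3, then F₁ sends i_{t+1} and i_{t+2} to (i+1)_{M(t+1)} and (i+1)_{M(t+2)}, both
-- different from (i+1)_{u+1}. For a rotation this forces M(t+1) = u+2 and M(t+2) = u, so
-- F₁[i] is the pair of paths i_t i_{t+1} (i+1)_{u+2} and i_{t+2} (i+1)_u (i+1)_{u+1}; for a
-- reflection it forces M(t+2) = u+2, and that arc is a component of F₁[i] of length 1.

open import Defs
open import Data.Nat using (ℕ; suc; _+_; _≤_; z≤n; s≤s; s≤s⁻¹; _%_)
open import Data.Nat.Properties using (1+n≢n; <⇒≢; m≤n⇒m<n∨m≡n)
open import Data.Nat.DivMod using (m<n⇒m%n≡m; n%n≡0)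
open import Data.Fin using (Fin; toℕ) renaming (zero to f0; suc to fs)
open import Data.Fin.Properties using (_≟_; all?; toℕ<n; toℕ-fromℕ<)
open import Data.Vec using (lookup; tabulate; _∷_; [])
open import Data.Vec.Properties using (lookup∘tabulate)
open import Data.Bool using (true; false; T)
open import Data.Empty using (⊥-elim)
open import Data.Product using (Σ; Σ-syntax; _×_; _,_; proj₁; proj₂; map; uncurry)
open import Data.Sum using (_⊎_; inj₁; inj₂; [_,_]′) renaming (map to ⊎-map)
open import Data.List using (_∷_; [])
open import Data.List.Relation.Unary.All using (_∷_; [])
open import Data.List.Relation.Unary.AllPairs using (_∷_; [])
open import Data.List.Relation.Unary.Unique.Propositional using (Unique)
open import Function using (id; _∘_)
open import Function.Definitions using (Injective)
open import Relation.Nullary using (¬_; Dec; yes; no)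
open import Relation.Nullary.Decidable using (from-yes; map′; ¬?; _⊎-dec_; _→-dec_)
open import Relation.Binary.PropositionalEquality
  using (_≡_; _≢_; _≗_; refl; sym; trans; cong; cong₂; subst; ≢-sym; module ≡-Reasoning)

private
  variable
    n : ℕ
    σ τ ρ₁ ρ₂ ρ₃ : Fin 3 → Fin 3

sucMod-irrefl : 2 ≤ n → (x : Fin n) → sucMod x ≢ x
sucMod-irrefl {suc m} (s≤s 1≤m) x x⁺≡x with m≤n⇒m<n∨m≡n (s≤s⁻¹ (toℕ<n x))
... | inj₁ x<m = 1+n≢n (begin
  suc (toℕ x)          ≡⟨ m<n⇒m%n≡m (s≤s x<m) ⟨
  suc (toℕ x) % suc m  ≡⟨ toℕ-fromℕ< _ ⟨
  toℕ (sucMod x)       ≡⟨ cong toℕ x⁺≡x ⟩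
  toℕ x                ∎)
  where open ≡-Reasoning
... | inj₂ x≡m = <⇒≢ 1≤m (begin
  0                    ≡⟨ n%n≡0 (suc m) ⟨
  suc m % suc m        ≡⟨ cong (λ k → suc k % suc m) x≡m ⟨
  suc (toℕ x) % suc m  ≡⟨ toℕ-fromℕ< _ ⟨
  toℕ (sucMod x)       ≡⟨ cong toℕ x⁺≡x ⟩
  toℕ x                ≡⟨ x≡m ⟩
  m                    ∎)
  where open ≡-Reasoning

sucMod≢ : (a : Fin 3) → sucMod a ≢ a
sucMod≢ = sucMod-irrefl (s≤s (s≤s z≤n))

sucMod²≢ : (a : Fin 3) → sucMod (sucMod a) ≢ a
sucMod²≢ f0 ()
sucMod²≢ (fs f0) ()
sucMod²≢ (fs (fs f0)) ()

sucMod³ : (a : Fin 3) → sucMod (sucMod (sucMod a)) ≡ a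
sucMod³ f0 = refl
sucMod³ (fs f0) = refl
sucMod³ (fs (fs f0)) = refl

sucMod-orbit : (a b : Fin 3) → b ≡ a ⊎ b ≡ sucMod a ⊎ b ≡ sucMod (sucMod a)
sucMod-orbit = from-yes (all? λ (a : Fin 3) → all? λ (b : Fin 3) →
  b ≟ a ⊎-dec b ≟ sucMod a ⊎-dec b ≟ sucMod (sucMod a))

≢⇒≡sucMod⊎≡sucMod² : {a b : Fin 3} → b ≢ a → b ≡ sucMod a ⊎ b ≡ sucMod (sucMod a)
≢⇒≡sucMod⊎≡sucMod² {a} {b} b≢a = [ ⊥-elim ∘ b≢a , id ]′ (sucMod-orbit a b)

≢sucMod⇒≢sucMod²⇒≡ : {a b : Fin 3} → sucMod a ≢ b → sucMod (sucMod a) ≢ b → b ≡ a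
≢sucMod⇒≢sucMod²⇒≡ {a} {b} ne₁ ne₂ =
  [ id , [ ⊥-elim ∘ ne₁ ∘ sym , ⊥-elim ∘ ne₂ ∘ sym ]′ ]′ (sucMod-orbit a b)

-- third a b is −(a + b) in ℤ₃: for a ≢ b it is the element distinct from both.
third : Fin 3 → Fin 3 → Fin 3
third f0 f0 = f0
third f0 (fs f0) = fs (fs f0)
third f0 (fs (fs f0)) = fs f0
third (fs f0) f0 = fs (fs f0)
third (fs f0) (fs f0) = fs f0
third (fs f0) (fs (fs f0)) = f0
third (fs (fs f0)) f0 = fs f0
third (fs (fs f0)) (fs f0) = f0
third (fs (fs f0)) (fs (fs f0)) = fs (fs f0)

third-unique : {a b h : Fin 3} → a ≢ b → h ≢ a → h ≢ b → h ≡ third a b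
third-unique {a} {b} {h} = from-yes (all? λ (a : Fin 3) → all? λ (b : Fin 3) → all? λ h →
  ¬? (a ≟ b) →-dec ¬? (h ≟ a) →-dec ¬? (h ≟ b) →-dec h ≟ third a b) a b h

third-sucMod : (a b : Fin 3) → third (sucMod a) (sucMod b) ≡ sucMod (third a b)
third-sucMod = from-yes (all? λ (a : Fin 3) → all? λ (b : Fin 3) →
  third (sucMod a) (sucMod b) ≟ sucMod (third a b))

Even Odd : (Fin 3 → Fin 3) → Set
Even σ = σ ≗ c012 ⊎ σ ≗ c021 ⊎ σ ≗ idP
Odd σ = σ ≗ t01 ⊎ σ ≗ t02 ⊎ σ ≗ t12

Apart : (Fin 3 → Fin 3) → (Fin 3 → Fin 3) → Set
Apart σ τ = ∀ j → σ j ≢ τ j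

Rotation Reflection : (Fin 3 → Fin 3) → Set
Rotation σ = ∀ j → σ (sucMod j) ≡ sucMod (σ j)
Reflection σ = ∀ j → σ (sucMod j) ≡ sucMod (sucMod (σ j))

_≗?_ : (σ τ : Fin 3 → Fin 3) → Dec (σ ≗ τ)
σ ≗? τ = all? λ j → σ j ≟ τ j

even? : (σ : Fin 3 → Fin 3) → Dec (Even σ)
even? σ = σ ≗? c012 ⊎-dec σ ≗? c021 ⊎-dec σ ≗? idP

odd? : (σ : Fin 3 → Fin 3) → Dec (Odd σ)
odd? σ = σ ≗? t01 ⊎-dec σ ≗? t02 ⊎-dec σ ≗? t12

rotation? : (σ : Fin 3 → Fin 3) → Dec (Rotation σ)
rotation? σ = all? λ j → σ (sucMod j) ≟ sucMod (σ j)

reflection? : (σ : Fin 3 → Fin 3) → Dec (Reflection σ)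
reflection? σ = all? λ j → σ (sucMod j) ≟ sucMod (sucMod (σ j))

injective? : (σ : Fin 3 → Fin 3) → Dec (Injective _≡_ _≡_ σ)
injective? σ = map′ (λ inj {x} {y} → inj x y) (λ inj x y → inj)
  (all? λ (x : Fin 3) → all? λ (y : Fin 3) → σ x ≟ σ y →-dec x ≟ y)

≗-injective : σ ≗ τ → Injective _≡_ _≡_ τ → Injective _≡_ _≡_ σ
≗-injective {σ} {τ} σ≗τ τ-inj {x} {y} σx≡σy =
  τ-inj (trans (sym (σ≗τ x)) (trans σx≡σy (σ≗τ y)))

≗-one-of : σ ≗ τ → σ ≗ ρ₁ ⊎ σ ≗ ρ₂ ⊎ σ ≗ ρ₃ → τ ≗ ρ₁ ⊎ τ ≗ ρ₂ ⊎ τ ≗ ρ₃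
≗-one-of {σ} {τ} σ≗τ = ⊎-map move (⊎-map move move)
  where
  move : ∀ {ρ} → σ ≗ ρ → τ ≗ ρ
  move σ≗ρ j = trans (sym (σ≗τ j)) (σ≗ρ j)

-- Checked by evaluation on the 27 tables lookup (a ∷ b ∷ c ∷ []); every map is
-- pointwise equal to its table.
opaque
  injective⇒even⊎odd : Injective _≡_ _≡_ σ → Even σ ⊎ Odd σ
  injective⇒even⊎odd {σ} σ-inj =
    ⊎-map (≗-one-of table≗σ) (≗-one-of table≗σ)
      (on-tables (σ f0) (σ (fs f0)) (σ (fs (fs f0))) (≗-injective table≗σ σ-inj))
    where
    table≗σ : lookup (tabulate σ) ≗ σ
    table≗σ = lookup∘tabulate σ
    on-tables : ∀ a b c → let τ = lookup (a ∷ b ∷ c ∷ []) in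
      Injective _≡_ _≡_ τ → Even τ ⊎ Odd τ
    on-tables = from-yes (all? λ (a : Fin 3) → all? λ (b : Fin 3) → all? λ c →
      let τ = lookup (a ∷ b ∷ c ∷ []) in injective? τ →-dec (even? τ ⊎-dec odd? τ))

agree-at : ∀ j → σ ≗ ρ₁ → τ ≗ ρ₂ → ρ₁ j ≡ ρ₂ j → Σ[ j ∈ Fin 3 ] σ j ≡ τ j
agree-at j p q e = j , trans (p j) (trans e (sym (q j)))

-- A rotation j ↦ j + a and a reflection j ↦ b − j meet at j = 2 (b − a).
even-odd-meet : Even σ → Odd τ → Σ[ j ∈ Fin 3 ] σ j ≡ τ j
even-odd-meet (inj₁ p)        (inj₁ q)        = agree-at f0 p q refl
even-odd-meet (inj₁ p)        (inj₂ (inj₁ q)) = agree-at (fs (fs f0)) p q refl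
even-odd-meet (inj₁ p)        (inj₂ (inj₂ q)) = agree-at (fs f0) p q refl
even-odd-meet (inj₂ (inj₁ p)) (inj₁ q)        = agree-at (fs f0) p q refl
even-odd-meet (inj₂ (inj₁ p)) (inj₂ (inj₁ q)) = agree-at f0 p q refl
even-odd-meet (inj₂ (inj₁ p)) (inj₂ (inj₂ q)) = agree-at (fs (fs f0)) p q refl
even-odd-meet (inj₂ (inj₂ p)) (inj₁ q)        = agree-at (fs (fs f0)) p q refl
even-odd-meet (inj₂ (inj₂ p)) (inj₂ (inj₁ q)) = agree-at (fs f0) p q refl
even-odd-meet (inj₂ (inj₂ p)) (inj₂ (inj₂ q)) = agree-at f0 p q refl

apart-same-parity : Injective _≡_ _≡_ σ → Injective _≡_ _≡_ τ → Apart σ τ →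
  (Even σ × Even τ) ⊎ (Odd σ × Odd τ)
apart-same-parity σ-inj τ-inj σ#τ with injective⇒even⊎odd σ-inj | injective⇒even⊎odd τ-inj
... | inj₁ σ-even | inj₁ τ-even = inj₁ (σ-even , τ-even)
... | inj₂ σ-odd  | inj₂ τ-odd  = inj₂ (σ-odd , τ-odd)
... | inj₁ σ-even | inj₂ τ-odd  = let (j , e) = even-odd-meet σ-even τ-odd in ⊥-elim (σ#τ j e)
... | inj₂ σ-odd  | inj₁ τ-even = let (j , e) = even-odd-meet τ-even σ-odd in ⊥-elim (σ#τ j (sym e))

even⇒rotation : Even σ → Rotation σ
even⇒rotation {σ} =
  [ via (from-yes (rotation? c012))
  , [ via (from-yes (rotation? c021)) , via (from-yes (rotation? idP)) ]′ ]′
  where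
  open ≡-Reasoning
  via : ∀ {ρ} → Rotation ρ → σ ≗ ρ → Rotation σ
  via {ρ} ρ-rot σ≗ρ j = begin
    σ (sucMod j)  ≡⟨ σ≗ρ (sucMod j) ⟩
    ρ (sucMod j)  ≡⟨ ρ-rot j ⟩
    sucMod (ρ j)  ≡⟨ cong sucMod (σ≗ρ j) ⟨
    sucMod (σ j)  ∎

odd⇒reflection : Odd σ → Reflection σ
odd⇒reflection {σ} =
  [ via (from-yes (reflection? t01))
  , [ via (from-yes (reflection? t02)) , via (from-yes (reflection? t12)) ]′ ]′
  where
  open ≡-Reasoning
  via : ∀ {ρ} → Reflection ρ → σ ≗ ρ → Reflection σ
  via {ρ} ρ-ref σ≗ρ j = begin
    σ (sucMod j)           ≡⟨ σ≗ρ (sucMod j) ⟩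
    ρ (sucMod j)           ≡⟨ ρ-ref j ⟩
    sucMod (sucMod (ρ j))  ≡⟨ cong (sucMod ∘ sucMod) (σ≗ρ j) ⟨
    sucMod (sucMod (σ j))  ∎

third-rotation : Rotation σ → Rotation τ → Rotation (λ j → third (σ j) (τ j))
third-rotation {σ} {τ} σ-rot τ-rot j = begin
  third (σ (sucMod j)) (τ (sucMod j))  ≡⟨ cong₂ third (σ-rot j) (τ-rot j) ⟩
  third (sucMod (σ j)) (sucMod (τ j))  ≡⟨ third-sucMod (σ j) (τ j) ⟩
  sucMod (third (σ j) (τ j))           ∎
  where open ≡-Reasoning

third-reflection : Reflection σ → Reflection τ → Reflection (λ j → third (σ j) (τ j))
third-reflection {σ} {τ} σ-ref τ-ref j = begin
  third (σ (sucMod j)) (τ (sucMod j))                    ≡⟨ cong₂ third (σ-ref j) (τ-ref j) ⟩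
  third (sucMod (sucMod (σ j))) (sucMod (sucMod (τ j)))  ≡⟨ third-sucMod (sucMod (σ j)) (sucMod (τ j)) ⟩
  sucMod (third (sucMod (σ j)) (sucMod (τ j)))           ≡⟨ cong sucMod (third-sucMod (σ j) (τ j)) ⟩
  sucMod (sucMod (third (σ j) (τ j)))                    ∎
  where open ≡-Reasoning

rotation-avoiding : Rotation σ → {t u : Fin 3} →
  σ (sucMod t) ≢ sucMod u → σ (sucMod (sucMod t)) ≢ sucMod u →
  σ (sucMod t) ≡ sucMod (sucMod u) × σ (sucMod (sucMod t)) ≡ u
rotation-avoiding {σ} σ-rot {t} {u} ne₁ ne₂ = trans σt⁺ (cong sucMod σt≡u⁺) , (begin
  σ (sucMod (sucMod t))       ≡⟨ σt⁺⁺ ⟩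
  sucMod (sucMod (σ t))       ≡⟨ cong (sucMod ∘ sucMod) σt≡u⁺ ⟩
  sucMod (sucMod (sucMod u))  ≡⟨ sucMod³ u ⟩
  u                           ∎)
  where
  open ≡-Reasoning
  σt⁺ : σ (sucMod t) ≡ sucMod (σ t)
  σt⁺ = σ-rot t
  σt⁺⁺ : σ (sucMod (sucMod t)) ≡ sucMod (sucMod (σ t))
  σt⁺⁺ = trans (σ-rot (sucMod t)) (cong sucMod σt⁺)
  σt≡u⁺ : σ t ≡ sucMod u
  σt≡u⁺ = sym (≢sucMod⇒≢sucMod²⇒≡ (ne₁ ∘ trans σt⁺) (ne₂ ∘ trans σt⁺⁺))

reflection-avoiding : Reflection σ → {t u : Fin 3} →
  σ (sucMod t) ≢ sucMod u → σ (sucMod (sucMod t)) ≢ sucMod u →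
  σ (sucMod (sucMod t)) ≡ sucMod (sucMod u)
reflection-avoiding {σ} σ-ref {t} {u} ne₁ ne₂ = trans σt⁺⁺ (cong sucMod σt≡u⁺)
  where
  σt⁺ : σ (sucMod t) ≡ sucMod (sucMod (σ t))
  σt⁺ = σ-ref t
  σt⁺⁺ : σ (sucMod (sucMod t)) ≡ sucMod (σ t)
  σt⁺⁺ = trans (σ-ref (sucMod t)) (trans (cong (sucMod ∘ sucMod) σt⁺) (sucMod³ (sucMod (σ t))))
  σt≡u⁺ : σ t ≡ sucMod u
  σt≡u⁺ = sym (≢sucMod⇒≢sucMod²⇒≡ (ne₂ ∘ trans σt⁺⁺) (ne₁ ∘ trans σt⁺))

isArc-inv : {g h : Fin n} {a b : Fin 3} → T (isArc (g , a) (h , b)) →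
  h ≡ sucMod g ⊎ (h ≡ g × b ≡ sucMod a)
isArc-inv {g = g} {h} {a} {b} arc with h ≟ sucMod g | g ≟ h | b ≟ sucMod a
... | yes h≡g⁺ | _       | _        = inj₁ h≡g⁺
... | no _     | yes g≡h | yes b≡a⁺ = inj₂ (sym g≡h , b≡a⁺)
... | no _     | yes _   | no _     = ⊥-elim arc
... | no _     | no _    | _        = ⊥-elim arc

isArc-same-layer : 2 ≤ n → {g : Fin n} {a b : Fin 3} → T (isArc (g , a) (g , b)) → b ≡ sucMod a
isArc-same-layer 2≤n {g} {a} {b} arc with isArc-inv {g = g} {g} {a} {b} arc
... | inj₁ g≡g⁺ = ⊥-elim (sucMod-irrefl 2≤n g (sym g≡g⁺))
... | inj₂ (_ , b≡a⁺) = b≡a⁺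

module _ {G : Subdigraph n} (G-2f : Is2Factor G) where

  out-unique : ∀ {u v w} → T (G u v) → T (G u w) → v ≡ w
  out-unique {u} p q = let (_ , _ , only) = proj₁ G-2f u in trans (only _ p) (sym (only _ q))

  in-unique : ∀ {u v w} → T (G u w) → T (G v w) → u ≡ v
  in-unique {w = w} p q = let (_ , _ , only) = proj₂ G-2f w in trans (only _ p) (sym (only _ q))

factor-unique : {F : Fin 4 → Subdigraph n} → Is2Factorization F →
  ∀ {k l u v} → T (F k u v) → T (F l u v) → k ≡ l
factor-unique (arcs , partition , _) p q =
  let (_ , _ , only) = partition _ _ (arcs _ _ _ p) in trans (only _ p) (sym (only _ q))

C3Arc : Subdigraph n → Fin n → Fin 3 → Set
C3Arc G i j = T (G (i , j) (i , sucMod j))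

b2n-sum≡0 : ∀ x y z → b2n x + b2n y + b2n z ≡ 0 → ¬ T x × ¬ T y × ¬ T z
b2n-sum≡0 false false false _ = (λ ()) , (λ ()) , (λ ())
b2n-sum≡0 true  _     _     ()
b2n-sum≡0 false true  _     ()
b2n-sum≡0 false false true  ()

b2n-sum≡1 : ∀ x y z → b2n x + b2n y + b2n z ≡ 1 →
  (T x × ¬ T y × ¬ T z) ⊎ (¬ T x × T y × ¬ T z) ⊎ (¬ T x × ¬ T y × T z)
b2n-sum≡1 true  false false _ = inj₁ (_ , (λ ()) , (λ ()))
b2n-sum≡1 false true  false _ = inj₂ (inj₁ ((λ ()) , _ , (λ ())))
b2n-sum≡1 false false true  _ = inj₂ (inj₂ ((λ ()) , (λ ()) , _))
b2n-sum≡1 true  true  _     ()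
b2n-sum≡1 true  false true  ()
b2n-sum≡1 false true  true  ()
b2n-sum≡1 false false false ()

type0-C3 : {G : Subdigraph n} {i : Fin n} → c3count G i ≡ 0 → ∀ j → ¬ C3Arc G i j
type0-C3 c0 with b2n-sum≡0 _ _ _ c0
... | ¬x , ¬y , ¬z = λ { f0 → ¬x ; (fs f0) → ¬y ; (fs (fs f0)) → ¬z }

type1-C3 : {G : Subdigraph n} {i : Fin n} → c3count G i ≡ 1 →
  Σ[ t ∈ Fin 3 ] C3Arc G i t × (∀ j → C3Arc G i j → j ≡ t)
type1-C3 c1 with b2n-sum≡1 _ _ _ c1
... | inj₁ (x , ¬y , ¬z) =
  f0 , x , λ { f0 _ → refl ; (fs f0) y → ⊥-elim (¬y y) ; (fs (fs f0)) z → ⊥-elim (¬z z) }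
... | inj₂ (inj₁ (¬x , y , ¬z)) =
  fs f0 , y , λ { f0 x → ⊥-elim (¬x x) ; (fs f0) _ → refl ; (fs (fs f0)) z → ⊥-elim (¬z z) }
... | inj₂ (inj₂ (¬x , ¬y , z)) =
  fs (fs f0) , z , λ { f0 x → ⊥-elim (¬x x) ; (fs f0) y → ⊥-elim (¬y y) ; (fs (fs f0)) _ → refl }

module _ {G : Subdigraph n} (arcs : ∀ u v → T (G u v) → T (isArc u v)) (G-2f : Is2Factor G)
         {i : Fin n} where

  next-layer-out : ∀ {j} → ¬ C3Arc G i j → Σ[ h ∈ Fin 3 ] T (G (i , j) (sucMod i , h))
  next-layer-out {j} no-C3 with proj₁ G-2f (i , j)
  ... | (g , h) , arc , _ with isArc-inv {g = i} {g} {j} {h} (arcs _ _ arc)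
  ...   | inj₁ refl = h , arc
  ...   | inj₂ (refl , refl) = ⊥-elim (no-C3 arc)

  type0-PiIs : c3count G i ≡ 0 → Σ (Fin 3 → Fin 3) (PiIs G i)
  type0-PiIs c0 = (λ j → proj₁ (out j)) , (λ j → proj₂ (out j))
    where
    out : ∀ j → Σ[ h ∈ Fin 3 ] T (G (i , j) (sucMod i , h))
    out j = next-layer-out (type0-C3 {G = G} {i} c0 j)

PiIs-arc : {G : Subdigraph n} {i : Fin n} → PiIs G i σ → ∀ {j h} → σ j ≡ h → T (G (i , j) (sucMod i , h))
PiIs-arc σ-arc {j} refl = σ-arc j

PiIs-resp : {G : Subdigraph n} {i : Fin n} → PiIs G i σ → σ ≗ τ → PiIs G i τ
PiIs-resp {G = G} {i} σ-arc σ≗τ j = PiIs-arc {G = G} {i} σ-arc (σ≗τ j)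

PiIs-one-of : {G : Subdigraph n} {i : Fin n} → PiIs G i σ →
  σ ≗ ρ₁ ⊎ σ ≗ ρ₂ ⊎ σ ≗ ρ₃ → PiIs G i ρ₁ ⊎ PiIs G i ρ₂ ⊎ PiIs G i ρ₃
PiIs-one-of {σ = σ} {G = G} {i} σ-arc = ⊎-map resp (⊎-map resp resp)
  where
  resp : ∀ {ρ} → σ ≗ ρ → PiIs G i ρ
  resp = PiIs-resp {G = G} {i} σ-arc

PiIs-injective : {G : Subdigraph n} {i : Fin n} → Is2Factor G → PiIs G i σ → Injective _≡_ _≡_ σ
PiIs-injective {G = G} {i} G-2f σ-arc {j} {k} σj≡σk =
  cong proj₂ (in-unique G-2f (σ-arc j) (PiIs-arc {G = G} {i} σ-arc (sym σj≡σk)))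

PiIs-apart : {F : Fin 4 → Subdigraph n} {i : Fin n} {k l : Fin 4} → Is2Factorization F → k ≢ l →
  PiIs (F k) i σ → PiIs (F l) i τ → Apart σ τ
PiIs-apart {F = F} {i} {l = l} fac k≢l σ-arc τ-arc j σj≡τj =
  k≢l (factor-unique fac (σ-arc j) (PiIs-arc {G = F l} {i} τ-arc (sym σj≡τj)))

WindowArc : Subdigraph n → Fin n → V n → V n → Set
WindowArc G i x y = T (G x y) × InWindow i x y

isolated-arc⇒¬switched : {G : Subdigraph n} {i : Fin n} {x y : V n} → WindowArc G i x y →
  (∀ z → ¬ WindowArc G i y z) → (∀ z → ¬ WindowArc G i z x) → ¬ SwitchedAt G i
isolated-arc⇒¬switched {x = x} {y} arc no-out no-in (a , b , c , d , e , f , _ , complete , sound)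
  with complete x y arc
... | inj₁ refl                = no-out c (sound b c (inj₂ (inj₁ refl)))
... | inj₂ (inj₁ refl)         = no-in a (sound a b (inj₁ refl))
... | inj₂ (inj₂ (inj₁ refl))  = no-out f (sound e f (inj₂ (inj₂ (inj₂ refl))))
... | inj₂ (inj₂ (inj₂ refl))  = no-in d (sound d e (inj₂ (inj₂ (inj₁ refl))))

module Window {n : ℕ} (2≤n : 2 ≤ n) (F : Fin 4 → Subdigraph n)
  (factorization : Is2Factorization F) (type1 : HasType 1 (F (fs f0)))
  (type0₂ : HasType 0 (F (fs (fs f0)))) (type0₃ : HasType 0 (F (fs (fs (fs f0)))))
  (i : Fin n) where

  F₁ F₂ F₃ : Subdigraph n
  F₁ = F (fs f0)
  F₂ = F (fs (fs f0))
  F₃ = F (fs (fs (fs f0)))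

  arcs : ∀ k u v → T (F k u v) → T (isArc u v)
  arcs = proj₁ factorization

  two-factor : ∀ k → Is2Factor (F k)
  two-factor = proj₂ (proj₂ factorization)

  s : Fin n
  s = sucMod i

  layer≢ : {a b : Fin 3} → (i , a) ≢ (s , b)
  layer≢ e = sucMod-irrefl 2≤n i (sym (cong proj₁ e))

  opaque
    π₂-exists : Σ (Fin 3 → Fin 3) (PiIs F₂ i)
    π₂-exists = type0-PiIs (arcs _) (two-factor _) (type0₂ i)

    π₃-exists : Σ (Fin 3 → Fin 3) (PiIs F₃ i)
    π₃-exists = type0-PiIs (arcs _) (two-factor _) (type0₃ i)

  π₂ π₃ : Fin 3 → Fin 3
  π₂ = proj₁ π₂-exists
  π₃ = proj₁ π₃-exists

  π₂-arc : PiIs F₂ i π₂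
  π₂-arc = proj₂ π₂-exists

  π₃-arc : PiIs F₃ i π₃
  π₃-arc = proj₂ π₃-exists

  π₂#π₃ : Apart π₂ π₃
  π₂#π₃ = PiIs-apart {F = F} {i} factorization (λ ()) π₂-arc π₃-arc

  parity : (Even π₂ × Even π₃) ⊎ (Odd π₂ × Odd π₃)
  parity = apart-same-parity
    (PiIs-injective {G = F₂} {i} (two-factor _) π₂-arc)
    (PiIs-injective {G = F₃} {i} (two-factor _) π₃-arc)
    π₂#π₃

  M : Fin 3 → Fin 3
  M j = third (π₂ j) (π₃ j)

  opaque
    t-exists : Σ[ t ∈ Fin 3 ] C3Arc F₁ i t × (∀ j → C3Arc F₁ i j → j ≡ t)
    t-exists = type1-C3 {G = F₁} {i} (type1 i)

    u-exists : Σ[ u ∈ Fin 3 ] C3Arc F₁ s u × (∀ j → C3Arc F₁ s j → j ≡ u)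
    u-exists = type1-C3 {G = F₁} {s} (type1 s)

  t u : Fin 3
  t = proj₁ t-exists
  u = proj₁ u-exists

  t-arc : C3Arc F₁ i t
  t-arc = proj₁ (proj₂ t-exists)

  u-arc : C3Arc F₁ s u
  u-arc = proj₁ (proj₂ u-exists)

  t-only : ∀ j → C3Arc F₁ i j → j ≡ t
  t-only = proj₂ (proj₂ t-exists)

  u-only : ∀ j → C3Arc F₁ s j → j ≡ u
  u-only = proj₂ (proj₂ u-exists)

  F₁-cross-target : ∀ {j h} → T (F₁ (i , j) (s , h)) → h ≡ M j
  F₁-cross-target {j} {h} arc = third-unique (π₂#π₃ j) (avoid (λ ()) π₂-arc) (avoid (λ ()) π₃-arc)
    where
    avoid : ∀ {k π} → fs f0 ≢ k → PiIs (F k) i π → h ≢ π j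
    avoid {k} 1≢k π-arc h≡πj =
      1≢k (factor-unique factorization arc (PiIs-arc {G = F k} {i} π-arc (sym h≡πj)))

  F₁-cross : ∀ {j} → j ≢ t → T (F₁ (i , j) (s , M j))
  F₁-cross {j} j≢t =
    let (h , arc) = next-layer-out (arcs _) (two-factor _) (j≢t ∘ t-only j)
    in subst (λ x → T (F₁ (i , j) (s , x))) (F₁-cross-target arc) arc

  M-avoids : ∀ {j} → j ≢ t → M j ≢ sucMod u
  M-avoids {j} j≢t Mj≡u⁺ =
    layer≢ (in-unique (two-factor _)
      (subst (λ x → T (F₁ (i , j) (s , x))) Mj≡u⁺ (F₁-cross j≢t)) u-arc)

  data F₁[i] (x y : V n) : Set where
    C3-at-i : x ≡ (i , t) → y ≡ (i , sucMod t) → F₁[i] x y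
    C3-at-s : x ≡ (s , u) → y ≡ (s , sucMod u) → F₁[i] x y
    crossing : ∀ {j} → j ≢ t → x ≡ (i , j) → y ≡ (s , M j) → F₁[i] x y

  classify : ∀ {x y} → WindowArc F₁ i x y → F₁[i] x y
  classify {_ , a} {_ , b} (arc , inj₁ (refl , refl))
    with refl ← isArc-same-layer 2≤n {i} {a} {b} (arcs _ _ _ arc)
    with refl ← t-only a arc = C3-at-i refl refl
  classify {_ , a} {_ , b} (arc , inj₂ (inj₁ (refl , refl)))
    with refl ← isArc-same-layer 2≤n {s} {a} {b} (arcs _ _ _ arc)
    with refl ← u-only a arc = C3-at-s refl refl
  classify {_ , a} {_ , b} (arc , inj₂ (inj₂ (refl , refl))) =
    crossing a≢t refl (cong (s ,_) (F₁-cross-target arc))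
    where
    a≢t : a ≢ t
    a≢t refl = layer≢ (out-unique (two-factor _) t-arc arc)

  F₁[i]-sound : ∀ {x y} → F₁[i] x y → WindowArc F₁ i x y
  F₁[i]-sound (C3-at-i refl refl)        = t-arc , inj₁ (refl , refl)
  F₁[i]-sound (C3-at-s refl refl)        = u-arc , inj₂ (inj₁ (refl , refl))
  F₁[i]-sound (crossing j≢t refl refl) = F₁-cross j≢t , inj₂ (inj₂ (refl , refl))

  pos≢ : {g : Fin n} {a b : Fin 3} → a ≢ b → (g , a) ≢ (g , b)
  pos≢ a≢b = a≢b ∘ cong proj₂

  switched : M (sucMod t) ≡ sucMod (sucMod u) → M (sucMod (sucMod t)) ≡ u → SwitchedAt F₁ i
  switched Mt⁺≡u⁺⁺ Mt⁺⁺≡u = a , b , c , d , e , f , distinct , on-paths , on-paths-sound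
    where
    a b c d e f : V n
    a = i , t
    b = i , sucMod t
    c = s , sucMod (sucMod u)
    d = i , sucMod (sucMod t)
    e = s , u
    f = s , sucMod u

    OnPaths : V n → V n → Set
    OnPaths x y = (x , y) ≡ (a , b) ⊎ (x , y) ≡ (b , c) ⊎ (x , y) ≡ (d , e) ⊎ (x , y) ≡ (e , f)

    distinct : Unique (a ∷ b ∷ c ∷ d ∷ e ∷ f ∷ [])
    distinct =
        (pos≢ (≢-sym (sucMod≢ t)) ∷ layer≢ ∷ pos≢ (≢-sym (sucMod²≢ t)) ∷ layer≢ ∷ layer≢ ∷ [])
      ∷ (layer≢ ∷ pos≢ (≢-sym (sucMod≢ (sucMod t))) ∷ layer≢ ∷ layer≢ ∷ [])
      ∷ (≢-sym layer≢ ∷ pos≢ (sucMod²≢ u) ∷ pos≢ (sucMod≢ (sucMod u)) ∷ [])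
      ∷ (layer≢ ∷ layer≢ ∷ [])
      ∷ (pos≢ (≢-sym (sucMod≢ u)) ∷ [])
      ∷ [] ∷ []

    on-paths : ∀ x y → WindowArc F₁ i x y → OnPaths x y
    on-paths x y arc with classify arc
    ... | C3-at-i refl refl = inj₁ refl
    ... | C3-at-s refl refl = inj₂ (inj₂ (inj₂ refl))
    ... | crossing j≢t refl refl with ≢⇒≡sucMod⊎≡sucMod² j≢t
    ...   | inj₁ refl = inj₂ (inj₁ (cong (λ h → (b , (s , h))) Mt⁺≡u⁺⁺))
    ...   | inj₂ refl = inj₂ (inj₂ (inj₁ (cong (λ h → (d , (s , h))) Mt⁺⁺≡u)))

    on-paths-sound : ∀ x y → OnPaths x y → WindowArc F₁ i x y
    on-paths-sound _ _ (inj₁ refl) = F₁[i]-sound (C3-at-i refl refl)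
    on-paths-sound _ _ (inj₂ (inj₁ refl)) =
      F₁[i]-sound (crossing (sucMod≢ t) refl (cong (s ,_) (sym Mt⁺≡u⁺⁺)))
    on-paths-sound _ _ (inj₂ (inj₂ (inj₁ refl))) =
      F₁[i]-sound (crossing (sucMod²≢ t) refl (cong (s ,_) (sym Mt⁺⁺≡u)))
    on-paths-sound _ _ (inj₂ (inj₂ (inj₂ refl))) = F₁[i]-sound (C3-at-s refl refl)

  unswitched : M (sucMod (sucMod t)) ≡ sucMod (sucMod u) → ¬ SwitchedAt F₁ i
  unswitched Mt⁺⁺≡u⁺⁺ = isolated-arc⇒¬switched {G = F₁} {i}
    (F₁[i]-sound (crossing (sucMod²≢ t) refl (cong (s ,_) (sym Mt⁺⁺≡u⁺⁺)))) no-out no-in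
    where
    no-out : ∀ z → ¬ WindowArc F₁ i (s , sucMod (sucMod u)) z
    no-out _ arc with classify arc
    ... | C3-at-i x≡ _   = layer≢ (sym x≡)
    ... | C3-at-s x≡ _   = sucMod²≢ u (cong proj₂ x≡)
    ... | crossing _ x≡ _ = layer≢ (sym x≡)

    no-in : ∀ z → ¬ WindowArc F₁ i z (i , sucMod (sucMod t))
    no-in _ arc with classify arc
    ... | C3-at-i _ y≡   = sucMod≢ (sucMod t) (cong proj₂ y≡)
    ... | C3-at-s _ y≡   = layer≢ y≡
    ... | crossing _ _ y≡ = layer≢ y≡

  M-rotation : Even π₂ × Even π₃ → Rotation M
  M-rotation (π₂-even , π₃-even) = third-rotation {π₂} {π₃} (even⇒rotation π₂-even) (even⇒rotation π₃-even)

  M-reflection : Odd π₂ × Odd π₃ → Reflection M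
  M-reflection (π₂-odd , π₃-odd) = third-reflection {π₂} {π₃} (odd⇒reflection π₂-odd) (odd⇒reflection π₃-odd)

  even⇒switched : Even π₂ × Even π₃ → SwitchedAt F₁ i
  even⇒switched even = uncurry switched
    (rotation-avoiding {σ = M} (M-rotation even) {t} {u} (M-avoids (sucMod≢ t)) (M-avoids (sucMod²≢ t)))

  odd⇒unswitched : Odd π₂ × Odd π₃ → ¬ SwitchedAt F₁ i
  odd⇒unswitched odd = unswitched
    (reflection-avoiding {σ = M} (M-reflection odd) {t} {u} (M-avoids (sucMod≢ t)) (M-avoids (sucMod²≢ t)))

  switched⇒even : SwitchedAt F₁ i → Even π₂ × Even π₃
  switched⇒even sw = [ id , (λ odd → ⊥-elim (odd⇒unswitched odd sw)) ]′ parity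

  unswitched⇒odd : ¬ SwitchedAt F₁ i → Odd π₂ × Odd π₃
  unswitched⇒odd ¬sw = [ (λ even → ⊥-elim (¬sw (even⇒switched even))) , id ]′ parity

-- F₀ enters only through the partition of the arcs.
lemma6p25 : (n : ℕ) → 2 ≤ n → (F : Fin 4 → Subdigraph n) → IsTypeII F →
    (i : Fin n) →
    (SwitchedAt (F (fs f0)) i →
       (PiIs (F (fs (fs f0))) i c012 ⊎ PiIs (F (fs (fs f0))) i c021 ⊎ PiIs (F (fs (fs f0))) i idP) ×
       (PiIs (F (fs (fs (fs f0)))) i c012 ⊎ PiIs (F (fs (fs (fs f0)))) i c021 ⊎ PiIs (F (fs (fs (fs f0)))) i idP)) ×
    (¬ SwitchedAt (F (fs f0)) i →
       (PiIs (F (fs (fs f0))) i t01 ⊎ PiIs (F (fs (fs f0))) i t02 ⊎ PiIs (F (fs (fs f0))) i t12) ×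
       (PiIs (F (fs (fs (fs f0)))) i t01 ⊎ PiIs (F (fs (fs (fs f0)))) i t02 ⊎ PiIs (F (fs (fs (fs f0)))) i t12))
lemma6p25 n 2≤n F (factorization , _ , type1 , type0₂ , type0₃) i =
  map (PiIs-one-of {G = F₂} {i} π₂-arc) (PiIs-one-of {G = F₃} {i} π₃-arc) ∘ switched⇒even ,
  map (PiIs-one-of {G = F₂} {i} π₂-arc) (PiIs-one-of {G = F₃} {i} π₃-arc) ∘ unswitched⇒odd
  where open Window 2≤n F factorization type1 type0₂ type0₃ i
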